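{- Let $I_2$ be an instance of the setup class model, $\varepsilon\in(0,1/2]$ with $1/\varepsilon\in\mathbb{Z}$ and $T>0$, in which every class has setup time at least $\varepsilon^3T$. Let $I_3$ be the instance obtained from $I_2$ by removing all jobs $j$ with $p_j<\varepsilon^4T$ and, for each class $k$, adding $\lceil(\sum_{j: k_j=k,\,p_j<\varepsilon^4T}p_j)/(\varepsilon^4T)\rceil$ new jobs of class $k$ with processing time $\varepsilon^4T$. Then for all $T',L'$: if there is a $(T',L')$-schedule for $I_2$, there is also a $((1+\varepsilon)T',L')$-schedule for $I_3$; and if there is a $(T',L')$-schedule for $I_3$, there is also a $((1+\varepsilon)T',L')$-schedule for $I_2$.
   Context: Setup class model: jobs $\mathcal{J}$, $m$ identical machines, classes; job $j$ has processing time $p_j>0$ and class $k_j$; class $k$ has setup time $s_k>0$. A schedule is an assignment $\sigma:\mathcal{J}\to[m]$; the load of machine $i$ is $\sum_{j\in\sigma^{ -1}(i)}p_j+\sum_{k\in\{k_j:j\in\sigma^{ -1}(i)\}}s_k$; the makespan is the maximum load. A $(T',L')$-schedule is a schedule with makespan at most $T'$ and free space $\sum_i(T'-\text{load}_i)\ge L'$. -}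

module Defs where

open import Data.Nat as ℕ using (ℕ)
open import Data.Integer as ℤ using (ℤ)
open import Data.Fin using (Fin)
open import Data.Fin.Properties using (any?)
open import Data.List using (List; []; _∷_; map; filter; length; lookup; allFin; _++_; concatMap; replicate; foldr)
open import Data.Product using (_×_; _,_; proj₁; proj₂; ∃)
open import Data.Bool using (if_then_else_)
open import Relation.Nullary using (does; ¬?; yes; no)
open import Relation.Nullary.Decidable using (_×-dec_)
open import Relation.Binary.PropositionalEquality using (_≡_)
open import Data.Rational using (ℚ; 0ℚ; 1ℚ; _+_; _*_; _-_; _≤_; _<_; _÷_; ≢-nonZero; ceiling; Positive)
open import Data.Rational.Properties using (_<?_; _≟_)
import Data.Fin.Properties as FinP

sumℚ : List ℚ → ℚ
sumℚ = foldr _+_ 0ℚ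

record Instance : Set where
  field
    m      : ℕ
    K      : ℕ
    setup  : Fin K → ℚ
    jobs   : List (ℚ × Fin K)
open Instance public

Job : Instance → Set
Job I = Fin (length (jobs I))

ptime : (I : Instance) → Job I → ℚ
ptime I j = proj₁ (lookup (jobs I) j)

cls : (I : Instance) → Job I → Fin (K I)
cls I j = proj₂ (lookup (jobs I) j)

ValidInstance : Instance → Set
ValidInstance I = (∀ (j : Job I) → 0ℚ < ptime I j) × (∀ (k : Fin (K I)) → 0ℚ < setup I k)

Schedule : Instance → Set
Schedule I = Job I → Fin (m I)

load : (I : Instance) → Schedule I → Fin (m I) → ℚ
load I σ i =
  sumℚ (map (ptime I) (filter (λ j → σ j FinP.≟ i) (allFin (length (jobs I)))))
  + sumℚ (map (λ k → if does (any? (λ j → (σ j FinP.≟ i) ×-dec (cls I j FinP.≟ k)))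
                      then setup I k else 0ℚ)
              (allFin (K I)))

IsSchedule : (I : Instance) → Schedule I → ℚ → ℚ → Set
IsSchedule I σ T' L' =
  (∀ (i : Fin (m I)) → load I σ i ≤ T')
  × (L' ≤ sumℚ (map (λ i → T' - load I σ i) (allFin (m I))))

HasSchedule : Instance → ℚ → ℚ → Set
HasSchedule I T' L' = ∃ λ (σ : Schedule I) → IsSchedule I σ T' L'

-- ⌈ x / d ⌉ as a natural number (for d ≠ 0; the value is irrelevant for d = 0,
-- and the result is taken as |⌈x/d⌉|, which equals ⌈x/d⌉ when x ≥ 0, d > 0).
ceilDiv : ℚ → ℚ → ℕ
ceilDiv x d with d ≟ 0ℚ
... | yes _  = 0
... | no d≢0 = ℤ.∣ ceiling ((x ÷ d) {{≢-nonZero d≢0}}) ∣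

roundSmall : Instance → ℚ → Instance
roundSmall I δ = record
  { m = m I
  ; K = K I
  ; setup = setup I
  ; jobs = filter (λ pk → ¬? (proj₁ pk <? δ)) (jobs I)
           ++ concatMap (λ k → replicate (ceilDiv (smallSum k) δ) (δ , k)) (allFin (K I))
  }
  where
    smallSum : Fin (K I) → ℚ
    smallSum k = sumℚ (map proj₁ (filter (λ pk → (proj₁ pk <? δ) ×-dec (proj₂ pk FinP.≟ k)) (jobs I)))

-- A schedule is read as a list of (job, machine) placements; machine loads depend only on the
-- multiset of placements. Both directions are one regrouping argument. Keep the large jobs where
-- they are, and for every class k pour the replacement jobs (the δ-blocks, resp. the original small
-- jobs, all of size at most δ = ε⁴T) greedily into the machines, filling machine i up to the class-k
-- small load it carried before. Because the number of blocks is a ceiling, the total capacity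
-- suffices in both directions, so every job gets placed. A machine overshoots its old class-k small
-- load by at most one item, and only for classes it already hosted, so each hosted class costs at
-- most δ = ε · ε³T ≤ ε · s_k extra: an ε-fraction of a setup time it already pays.

module Submission where

open import Data.Bool using (true; false; _∧_; if_then_else_)
open import Data.Bool.Properties using (∧-comm)
open import Data.Fin using (Fin; zero; suc)
open import Data.Fin.Properties using (any?; suc-injective) renaming (_≟_ to _≟ᶠ_)
open import Data.Integer as ℤ using (ℤ)
import Data.Integer.Properties as ℤ
open import Data.Integer.DivMod using (_/ℕ_; div-pos-is-/ℕ; [n/ℕd]*d≤n; n<s[n/ℕd]*d)
open import Data.Integer.Solver using () renaming (module +-*-Solver to ℤ-Solver)
open import Data.List using (List; []; _∷_; map; filter; allFin; _++_; concatMap; concat; replicate; tabulate; lookup; length)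
open import Data.List.Properties
  using (map-cong; map-∘; map-id; map-++; map-tabulate; map-replicate; map-concatMap; tabulate-lookup; concatMap-cong;
         filter-++; filter-all; filter-none; filter-accept; filter-reject; ∷-injective)
open import Data.List.Relation.Binary.Permutation.Propositional as ↭
  using (_↭_; ↭-refl; ↭-sym; ↭-trans; ↭-reflexive; ↭-prep; module PermutationReasoning)
open import Data.List.Relation.Binary.Permutation.Propositional.Properties
  using (shift; ++⁺ˡ; Any-resp-↭; All-resp-↭; ↭-map-inv; filter-↭)
open import Data.List.Relation.Unary.All as All using (All; []; _∷_)
import Data.List.Relation.Unary.All.Properties as All
open import Data.List.Relation.Unary.Any as Any using (Any)
import Data.List.Relation.Unary.Any.Properties as Any
open import Data.Nat using (ℕ; zero; suc; z≤n)
open import Data.Nat.Coprimality using (Coprime)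
open import Data.Product as Product using (_×_; _,_; proj₁; proj₂; ∃; ∃₂; Σ-syntax)
open import Data.Sum as Sum using (_⊎_; inj₁; inj₂)
open import Data.Rational
  using (ℚ; mkℚ; 0ℚ; 1ℚ; ½; _+_; _*_; _-_; -_; _/_; _÷_; 1/_; _≤_; _<_; *≤*; *<*; ceiling;
         ≢-nonZero; positive; nonNegative; NonZero; Positive)
open import Data.Rational.Literals using (fromℤ)
open import Data.Rational.Properties
import Data.Rational.Unnormalised as ℚᵘ
import Data.Rational.Unnormalised.Properties as ℚᵘ
open import Data.Rational.Solver using (module +-*-Solver)
open import Function using (_∘_; mk⇔)
open import Level using (0ℓ)
open import Relation.Binary.PropositionalEquality
open import Relation.Nullary using (¬_; Dec; does; yes; no; ¬?; _×-dec_; contradiction)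
open import Relation.Nullary.Decidable using (does-⇔; dec-true; dec-false)
open import Relation.Unary using (Pred; Decidable)

open import Defs

private
  variable
    A B : Set

sumOf : (A → ℚ) → List A → ℚ
sumOf f xs = sumℚ (map f xs)

module _ {f g : A → ℚ} where

  sumOf-cong : (∀ x → f x ≡ g x) → ∀ xs → sumOf f xs ≡ sumOf g xs
  sumOf-cong f≗g xs = cong sumℚ (map-cong f≗g xs)

  sumOf-+ : ∀ xs → sumOf (λ x → f x + g x) xs ≡ sumOf f xs + sumOf g xs
  sumOf-+ [] = refl
  sumOf-+ (x ∷ xs) = trans (cong (f x + g x +_) (sumOf-+ xs)) (interchange (f x) (g x) _ _)
    where
    open +-*-Solver
    interchange : ∀ a b c d → (a + b) + (c + d) ≡ (a + c) + (b + d)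
    interchange = solve 4 (λ a b c d → (a :+ b) :+ (c :+ d) := (a :+ c) :+ (b :+ d)) refl

  sumOf-mono : ∀ {xs} → All (λ x → f x ≤ g x) xs → sumOf f xs ≤ sumOf g xs
  sumOf-mono []         = ≤-refl
  sumOf-mono (fx≤gx ∷ p) = +-mono-≤ fx≤gx (sumOf-mono p)

module _ (f : A → ℚ) where

  sumOf-++ : ∀ xs ys → sumOf f (xs ++ ys) ≡ sumOf f xs + sumOf f ys
  sumOf-++ []       ys = sym (+-identityˡ _)
  sumOf-++ (x ∷ xs) ys = trans (cong (f x +_) (sumOf-++ xs ys)) (sym (+-assoc (f x) _ _))

  sumOf-filter-++ : {P : Pred A 0ℓ} (P? : Decidable P) →
                    ∀ xs ys → sumOf f (filter P? (xs ++ ys)) ≡ sumOf f (filter P? xs) + sumOf f (filter P? ys)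
  sumOf-filter-++ P? xs ys = trans (cong (sumOf f) (filter-++ P? xs ys)) (sumOf-++ (filter P? xs) _)

  sumOf-filter-concatMap : {P : Pred A 0ℓ} (P? : Decidable P) (g : B → List A) →
                           ∀ ks → sumOf f (filter P? (concatMap g ks)) ≡ sumOf (λ k → sumOf f (filter P? (g k))) ks
  sumOf-filter-concatMap P? g []       = refl
  sumOf-filter-concatMap P? g (k ∷ ks) =
    trans (sumOf-filter-++ P? (g k) _) (cong (sumOf f (filter P? (g k)) +_) (sumOf-filter-concatMap P? g ks))

  sumOf-*ˡ : ∀ c xs → sumOf (λ x → c * f x) xs ≡ c * sumOf f xs
  sumOf-*ˡ c []       = sym (*-zeroʳ c)
  sumOf-*ˡ c (x ∷ xs) = trans (cong (c * f x +_) (sumOf-*ˡ c xs)) (sym (*-distribˡ-+ c _ _))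

  sumOf-zero : ∀ {xs} → All (λ x → f x ≡ 0ℚ) xs → sumOf f xs ≡ 0ℚ
  sumOf-zero []           = refl
  sumOf-zero (fx≡0 ∷ p) = trans (cong₂ _+_ fx≡0 (sumOf-zero p)) (+-identityˡ 0ℚ)

  sumOf-map : (g : B → A) → ∀ xs → sumOf f (map g xs) ≡ sumOf (f ∘ g) xs
  sumOf-map g xs = cong sumℚ (sym (map-∘ xs))

  sumOf-↭ : ∀ {xs ys} → xs ↭ ys → sumOf f xs ≡ sumOf f ys
  sumOf-↭ ↭.refl         = refl
  sumOf-↭ (↭.prep x p)   = cong (f x +_) (sumOf-↭ p)
  sumOf-↭ (↭.swap x y p) = trans (cong (λ s → f x + (f y + s)) (sumOf-↭ p)) (exchange (f x) (f y) _)
    where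
    open +-*-Solver
    exchange : ∀ a b c → a + (b + c) ≡ b + (a + c)
    exchange = solve 3 (λ a b c → a :+ (b :+ c) := b :+ (a :+ c)) refl
  sumOf-↭ (↭.trans p q)  = trans (sumOf-↭ p) (sumOf-↭ q)

  sumOf-filter : {P : Pred A 0ℓ} (P? : Decidable P) →
                 ∀ xs → sumOf f (filter P? xs) ≡ sumOf (λ x → if does (P? x) then f x else 0ℚ) xs
  sumOf-filter P? []       = refl
  sumOf-filter P? (x ∷ xs) with does (P? x)
  ... | true  = cong (f x +_) (sumOf-filter P? xs)
  ... | false = trans (sumOf-filter P? xs) (sym (+-identityˡ _))

sumOf-nonneg : (f : A → ℚ) → ∀ {xs} → All (λ x → 0ℚ ≤ f x) xs → 0ℚ ≤ sumOf f xs
sumOf-nonneg f {xs} 0≤f = subst (_≤ sumOf f xs) (sumOf-zero (λ _ → 0ℚ) (All.universal (λ _ → refl) xs)) (sumOf-mono 0≤f)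

sumOf-comm : (g : A → B → ℚ) (xs : List A) (ys : List B) →
             sumOf (λ x → sumOf (g x) ys) xs ≡ sumOf (λ y → sumOf (λ x → g x y) xs) ys
sumOf-comm g []       ys = sym (sumOf-zero (λ _ → 0ℚ) (All.universal (λ _ → refl) ys))
sumOf-comm g (x ∷ xs) ys = trans (cong (sumOf (g x) ys +_) (sumOf-comm g xs ys)) (sym (sumOf-+ ys))

sumOf-tabulate : ∀ {n} (g : A → ℚ) (h : Fin n → A) → sumOf g (tabulate h) ≡ sumOf (g ∘ h) (allFin n)
sumOf-tabulate g h = cong sumℚ (trans (map-tabulate h g) (sym (map-tabulate (λ j → j) (g ∘ h))))

sumOf-allFin-single : ∀ {n} (f : Fin n → ℚ) c → (∀ k → ¬ k ≡ c → f k ≡ 0ℚ) → sumOf f (allFin n) ≡ f c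
sumOf-allFin-single f c off = trans (cong sumℚ (map-tabulate (λ k → k) f)) (tabulate-single f c off)
  where
  tabulate-zero : ∀ {n} (g : Fin n → ℚ) → (∀ k → g k ≡ 0ℚ) → sumℚ (tabulate g) ≡ 0ℚ
  tabulate-zero {zero}  g z = refl
  tabulate-zero {suc n} g z = trans (cong₂ _+_ (z zero) (tabulate-zero (g ∘ suc) (z ∘ suc))) (+-identityˡ 0ℚ)
  tabulate-single : ∀ {n} (g : Fin n → ℚ) c → (∀ k → ¬ k ≡ c → g k ≡ 0ℚ) → sumℚ (tabulate g) ≡ g c
  tabulate-single {suc n} g zero    off =
    trans (cong (g zero +_) (tabulate-zero (g ∘ suc) (λ k → off (suc k) λ ()))) (+-identityʳ _)
  tabulate-single {suc n} g (suc c) off =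
    trans (cong₂ _+_ (off zero λ ()) (tabulate-single (g ∘ suc) c (λ k k≢c → off (suc k) (k≢c ∘ suc-injective))))
          (+-identityˡ _)

sumOf-allFin-indicator : ∀ {n} (c : Fin n) b a →
                         sumOf (λ k → if b ∧ does (c ≟ᶠ k) then a else 0ℚ) (allFin n) ≡ (if b then a else 0ℚ)
sumOf-allFin-indicator {n} c false a = sumOf-zero (λ _ → 0ℚ) (All.universal (λ _ → refl) (allFin n))
sumOf-allFin-indicator c true  a = trans (sumOf-allFin-single _ c off) (cong (λ b → if b then a else 0ℚ) (dec-true (c ≟ᶠ c) refl))
  where
  off : ∀ k → ¬ k ≡ c → (if does (c ≟ᶠ k) then a else 0ℚ) ≡ 0ℚ
  off k k≢c = cong (λ b → if b then a else 0ℚ) (dec-false (c ≟ᶠ k) (k≢c ∘ sym))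

module _ {P : Pred B 0ℓ} (P? : Decidable P) (f : A → B) where

  map-filter : ∀ xs → map f (filter (P? ∘ f) xs) ≡ filter P? (map f xs)
  map-filter []       = refl
  map-filter (x ∷ xs) with does (P? (f x))
  ... | true  = cong (f x ∷_) (map-filter xs)
  ... | false = map-filter xs

module _ {P : Pred A 0ℓ} (P? : Decidable P) where

  ↭-filter-split : ∀ xs → xs ↭ filter (¬? ∘ P?) xs ++ filter P? xs
  ↭-filter-split []       = ↭-refl
  ↭-filter-split (x ∷ xs) with P? x
  ... | yes _ = ↭-trans (↭-prep x (↭-filter-split xs)) (↭-sym (shift x (filter (¬? ∘ P?) xs) _))
  ... | no  _ = ↭-prep x (↭-filter-split xs)

concatMap-allFin-suc : ∀ {n} (F : Fin (suc n) → List A) →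
                       concatMap F (allFin (suc n)) ≡ F zero ++ concatMap (F ∘ suc) (allFin n)
concatMap-allFin-suc F = cong (λ xss → F zero ++ concat xss)
  (trans (map-tabulate suc F) (sym (map-tabulate (λ k → k) (F ∘ suc))))

concatMap-insert : ∀ {n} (F G : Fin n → List A) (x : A) c →
                   G c ≡ x ∷ F c → (∀ k → ¬ k ≡ c → G k ≡ F k) →
                   concatMap G (allFin n) ↭ x ∷ concatMap F (allFin n)
concatMap-insert {n = suc n} F G x zero Gc off = ↭-reflexive (begin
  concatMap G (allFin (suc n))                 ≡⟨ concatMap-allFin-suc G ⟩
  G zero ++ concatMap (G ∘ suc) (allFin n)     ≡⟨ cong₂ _++_ Gc (concatMap-cong (λ k → off (suc k) λ ()) (allFin n)) ⟩
  x ∷ F zero ++ concatMap (F ∘ suc) (allFin n) ≡⟨ cong (x ∷_) (concatMap-allFin-suc F) ⟨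
  x ∷ concatMap F (allFin (suc n))             ∎)
  where open ≡-Reasoning
concatMap-insert {n = suc n} F G x (suc c) Gc off = begin
  concatMap G (allFin (suc n))                 ≡⟨ concatMap-allFin-suc G ⟩
  G zero ++ concatMap (G ∘ suc) (allFin n)     ≡⟨ cong (_++ _) (off zero λ ()) ⟩
  F zero ++ concatMap (G ∘ suc) (allFin n)     ↭⟨ ++⁺ˡ (F zero) (concatMap-insert (F ∘ suc) (G ∘ suc) x c Gc
                                                    (λ k k≢c → off (suc k) (k≢c ∘ suc-injective))) ⟩
  F zero ++ x ∷ concatMap (F ∘ suc) (allFin n) ↭⟨ shift x (F zero) _ ⟩
  x ∷ F zero ++ concatMap (F ∘ suc) (allFin n) ≡⟨ cong (x ∷_) (concatMap-allFin-suc F) ⟨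
  x ∷ concatMap F (allFin (suc n))             ∎
  where open PermutationReasoning

module _ {P : Pred A 0ℓ} (P? : Decidable P) {n : ℕ} (key : A → Fin n) where

  private
    withKey? : (k : Fin n) → Decidable (λ x → P x × key x ≡ k)
    withKey? k x = P? x ×-dec (key x ≟ᶠ k)

  filter-↭-concatMap-byKey : ∀ xs → filter P? xs ↭ concatMap (λ k → filter (λ x → P? x ×-dec (key x ≟ᶠ k)) xs) (allFin n)
  filter-↭-concatMap-byKey []       = ↭-sym (↭-reflexive (concatMap-nil (allFin n)))
    where
    concatMap-nil : (ks : List (Fin n)) → concatMap (λ _ → []) ks ≡ []
    concatMap-nil []       = refl
    concatMap-nil (_ ∷ ks) = concatMap-nil ks
  filter-↭-concatMap-byKey (x ∷ xs) = byCase (P? x)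
    where
    byCase : Dec (P x) → filter P? (x ∷ xs) ↭ concatMap (λ k → filter (withKey? k) (x ∷ xs)) (allFin n)
    byCase (yes px) = begin
      filter P? (x ∷ xs)                                   ≡⟨ filter-accept P? px ⟩
      x ∷ filter P? xs                                     ↭⟨ ↭-prep x (filter-↭-concatMap-byKey xs) ⟩
      x ∷ concatMap (λ k → filter (withKey? k) xs) (allFin n) ↭⟨ concatMap-insert _ _ x (key x)
                                                              (filter-accept (withKey? (key x)) (px , refl))
                                                              (λ k k≢key → filter-reject (withKey? k) (λ (_ , key≡k) → k≢key (sym key≡k))) ⟨
      concatMap (λ k → filter (withKey? k) (x ∷ xs)) (allFin n) ∎
      where open PermutationReasoning
    byCase (no ¬px) = begin
      filter P? (x ∷ xs)                                   ≡⟨ filter-reject P? ¬px ⟩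
      filter P? xs                                         ↭⟨ filter-↭-concatMap-byKey xs ⟩
      concatMap (λ k → filter (withKey? k) xs) (allFin n)   ≡⟨ concatMap-cong (λ k → filter-reject (withKey? k) (¬px ∘ proj₁)) (allFin n) ⟨
      concatMap (λ k → filter (withKey? k) (x ∷ xs)) (allFin n) ∎
      where open PermutationReasoning

module _ {P Q : Pred A 0ℓ} (P? : Decidable P) (Q? : Decidable Q) where

  filter-filter : ∀ xs → filter Q? (filter P? xs) ≡ filter (λ x → P? x ×-dec Q? x) xs
  filter-filter []       = refl
  filter-filter (x ∷ xs) with P? x
  ... | no  _ = filter-filter xs
  ... | yes _ with Q? x
  ...   | yes _ = cong (x ∷_) (filter-filter xs)
  ...   | no  _ = filter-filter xs

map-++⁻ : (f : A → B) (zs : List A) {xs ys : List B} → map f zs ≡ xs ++ ys →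
          ∃₂ λ zs₁ zs₂ → zs ≡ zs₁ ++ zs₂ × map f zs₁ ≡ xs × map f zs₂ ≡ ys
map-++⁻ f zs       {[]}     eq = [] , zs , refl , refl , eq
map-++⁻ f (z ∷ zs) {x ∷ xs} eq with map-++⁻ f zs (proj₂ (∷-injective eq))
... | zs₁ , zs₂ , zs≡ , eq₁ , eq₂ = z ∷ zs₁ , zs₂ , cong (z ∷_) zs≡ , cong₂ _∷_ (proj₁ (∷-injective eq)) eq₁ , eq₂

-- Rational arithmetic and ceilings

+-cancelˡ-≤ : ∀ a {b c} → a + b ≤ a + c → b ≤ c
+-cancelˡ-≤ a {b} {c} a+b≤a+c = subst₂ _≤_ (cancel b) (cancel c) (+-monoʳ-≤ (- a) a+b≤a+c)
  where
  open +-*-Solver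
  cancel : ∀ x → - a + (a + x) ≡ x
  cancel x = solve 2 (λ a x → :- a :+ (a :+ x) := x) refl a x

p≤p+q : ∀ {p q} → 0ℚ ≤ q → p ≤ p + q
p≤p+q {p} 0≤q = subst (_≤ p + _) (+-identityʳ p) (+-monoʳ-≤ p 0≤q)

*-pos : ∀ {p q} → 0ℚ < p → 0ℚ < q → 0ℚ < p * q
*-pos {p} {q} 0<p 0<q = positive⁻¹ (p * q) {{pos*pos⇒pos p {{positive 0<p}} q {{positive 0<q}}}}

fromℤ-+ : ∀ a b → fromℤ (a ℤ.+ b) ≡ fromℤ a + fromℤ b
fromℤ-+ a b = toℚᵘ-injective (ℚᵘ.≃-sym (ℚᵘ.≃-trans (toℚᵘ-homo-+ (fromℤ a) (fromℤ b)) (ℚᵘ.*≡* cross)))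
  where
  open ℤ-Solver
  cross : (a ℤ.* ℤ.1ℤ ℤ.+ b ℤ.* ℤ.1ℤ) ℤ.* ℤ.1ℤ ≡ (a ℤ.+ b) ℤ.* (ℤ.1ℤ ℤ.* ℤ.1ℤ)
  cross = solve 2 (λ a b → (a :* con ℤ.1ℤ :+ b :* con ℤ.1ℤ) :* con ℤ.1ℤ := (a :+ b) :* (con ℤ.1ℤ :* con ℤ.1ℤ)) refl a b

sumℚ-replicate : ∀ n d → sumℚ (replicate n d) ≡ fromℤ (ℤ.+ n) * d
sumℚ-replicate zero    d = sym (*-zeroˡ d)
sumℚ-replicate (suc n) d = begin
  d + sumℚ (replicate n d)       ≡⟨ cong (d +_) (sumℚ-replicate n d) ⟩
  d + fromℤ (ℤ.+ n) * d          ≡⟨ solve 2 (λ d n → d :+ n :* d := (con 1ℚ :+ n) :* d) refl d (fromℤ (ℤ.+ n)) ⟩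
  (1ℚ + fromℤ (ℤ.+ n)) * d       ≡⟨ cong (_* d) (fromℤ-+ ℤ.1ℤ (ℤ.+ n)) ⟨
  fromℤ (ℤ.+ suc n) * d          ∎
  where open ≡-Reasoning; open +-*-Solver

ceiling-nonneg : ∀ n d-1 .(c : Coprime n (suc d-1)) →
                 ceiling (mkℚ (ℤ.+ n) d-1 c) ≡ ℤ.- (ℤ.- (ℤ.+ n) /ℕ suc d-1)
ceiling-nonneg zero    d-1 _ = cong ℤ.-_ (div-pos-is-/ℕ ℤ.0ℤ (suc d-1))
ceiling-nonneg (suc n) d-1 _ = cong ℤ.-_ (div-pos-is-/ℕ ℤ.-[1+ n ] (suc d-1))

-- For q = n/d ≥ 0 the ceiling is -⌊-n/d⌋, and Euclidean division of -n by d brackets it.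
ceiling-bounds : ∀ q → 0ℚ ≤ q → q ≤ fromℤ (ℤ.+ ℤ.∣ ceiling q ∣) × fromℤ (ℤ.+ ℤ.∣ ceiling q ∣) < q + 1ℚ
ceiling-bounds (mkℚ ℤ.-[1+ _ ] _ _) (*≤* ())
ceiling-bounds q@(mkℚ (ℤ.+ n) d-1 cop) _ =
  subst (λ z → q ≤ fromℤ z × fromℤ z < q + 1ℚ) (sym |⌈q⌉|≡c) (q≤c , c<q+1)
  where
  open ℤ-Solver
  D = ℤ.+ suc d-1
  f = ℤ.- (ℤ.+ n) /ℕ suc d-1
  c = ℤ.- f
  n≤cD : ℤ.+ n ℤ.≤ c ℤ.* D
  n≤cD = subst₂ ℤ._≤_ (ℤ.neg-involutive (ℤ.+ n)) (ℤ.neg-distribˡ-* f D)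
                      (ℤ.neg-mono-≤ ([n/ℕd]*d≤n (ℤ.- (ℤ.+ n)) (suc d-1)))
  c-1D<n : (c ℤ.+ ℤ.-1ℤ) ℤ.* D ℤ.< ℤ.+ n
  c-1D<n = subst₂ ℤ._<_ (solve 2 (λ f d → :- ((con ℤ.1ℤ :+ f) :* d) := (:- f :+ con ℤ.-1ℤ) :* d) refl f D)
                        (ℤ.neg-involutive (ℤ.+ n)) (ℤ.neg-mono-< (n<s[n/ℕd]*d (ℤ.- (ℤ.+ n)) (suc d-1)))
  |⌈q⌉|≡c : ℤ.+ ℤ.∣ ceiling q ∣ ≡ c
  |⌈q⌉|≡c = trans (cong (λ z → ℤ.+ ℤ.∣ z ∣) (ceiling-nonneg n d-1 cop))
                  (ℤ.0≤i⇒+∣i∣≡i (ℤ.*-cancelʳ-≤-pos ℤ.0ℤ c D (ℤ.≤-trans (ℤ.+≤+ z≤n) n≤cD)))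
  q≤c : q ≤ fromℤ c
  q≤c = *≤* (subst (ℤ._≤ c ℤ.* D) (sym (ℤ.*-identityʳ (ℤ.+ n))) n≤cD)
  c-1<q : fromℤ (c ℤ.+ ℤ.-1ℤ) < q
  c-1<q = *<* (subst ((c ℤ.+ ℤ.-1ℤ) ℤ.* D ℤ.<_) (sym (ℤ.*-identityʳ (ℤ.+ n))) c-1D<n)
  c<q+1 : fromℤ c < q + 1ℚ
  c<q+1 = subst (_< q + 1ℚ) (sym (trans (cong fromℤ (solve 1 (λ c → c := (c :+ con ℤ.-1ℤ) :+ con ℤ.1ℤ) refl c))
                                        (fromℤ-+ (c ℤ.+ ℤ.-1ℤ) ℤ.1ℤ)))
                (+-monoˡ-< 1ℚ c-1<q)

ceilDiv-bounds : ∀ x d → 0ℚ ≤ x → 0ℚ < d →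
                 x ≤ sumℚ (replicate (ceilDiv x d) d) × sumℚ (replicate (ceilDiv x d) d) < x + d
ceilDiv-bounds x d 0≤x 0<d with d ≟ 0ℚ
... | yes d≡0 = contradiction 0<d (<-irrefl (sym d≡0))
... | no d≢0 = x≤Nd , Nd<x+d
  where
  instance
    _ : NonZero d
    _ = ≢-nonZero d≢0
    _ : Positive d
    _ = positive 0<d
  q = x ÷ d
  N = ℤ.∣ ceiling q ∣
  qd≡x : q * d ≡ x
  qd≡x = trans (*-assoc x (1/ d) d) (trans (cong (x *_) (*-inverseˡ d)) (*-identityʳ x))
  0≤q : 0ℚ ≤ q
  0≤q = *-cancelʳ-≤-pos d (subst₂ _≤_ (sym (*-zeroˡ d)) (sym qd≡x) 0≤x)
  x≤Nd : x ≤ sumℚ (replicate N d)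
  x≤Nd = subst₂ _≤_ qd≡x (sym (sumℚ-replicate N d))
                (*-monoʳ-≤-nonNeg d {{pos⇒nonNeg d}} (proj₁ (ceiling-bounds q 0≤q)))
  Nd<x+d : sumℚ (replicate N d) < x + d
  Nd<x+d = subst₂ _<_ (sym (sumℚ-replicate N d)) (trans (*-distribʳ-+ d q 1ℚ) (cong₂ _+_ qd≡x (*-identityˡ d)))
                  (*-monoˡ-<-pos d (proj₂ (ceiling-bounds q 0≤q)))

Placement : ℕ → ℕ → Set
Placement m K = (ℚ × Fin K) × Fin m

module _ {m K : ℕ} where

  timeOf : Placement m K → ℚ
  timeOf = proj₁ ∘ proj₁

  classOf : Placement m K → Fin K
  classOf = proj₂ ∘ proj₁

  machineOf : Placement m K → Fin m
  machineOf = proj₂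

  onMachine? : (i : Fin m) → Decidable (λ e → machineOf e ≡ i)
  onMachine? i e = machineOf e ≟ᶠ i

  onMachineAs? : (i : Fin m) (k : Fin K) → Decidable (λ e → machineOf e ≡ i × classOf e ≡ k)
  onMachineAs? i k e = onMachine? i e ×-dec (classOf e ≟ᶠ k)

  Hosts : List (Placement m K) → Fin m → Fin K → Set
  Hosts zs i k = Any (λ e → machineOf e ≡ i × classOf e ≡ k) zs

  hosts? : ∀ zs i k → Dec (Hosts zs i k)
  hosts? zs i k = Any.any? (onMachineAs? i k) zs

  loadOn : Fin m → List (Placement m K) → ℚ
  loadOn i zs = sumOf timeOf (filter (onMachine? i) zs)

  classLoad : List (Placement m K) → Fin m → Fin K → ℚ
  classLoad zs i k = sumOf timeOf (filter (onMachineAs? i k) zs)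

  setupCost : (Fin K → ℚ) → List (Placement m K) → Fin m → Fin K → ℚ
  setupCost s zs i k = if does (hosts? zs i k) then s k else 0ℚ

  machineLoad : (Fin K → ℚ) → List (Placement m K) → Fin m → ℚ
  machineLoad s zs i = sumOf (classLoad zs i) (allFin K) + sumOf (setupCost s zs i) (allFin K)

  classLoad-++ : ∀ xs ys i k → classLoad (xs ++ ys) i k ≡ classLoad xs i k + classLoad ys i k
  classLoad-++ xs ys i k = sumOf-filter-++ timeOf (onMachineAs? i k) xs ys

  classLoad-↭ : ∀ {xs ys} → xs ↭ ys → ∀ i k → classLoad xs i k ≡ classLoad ys i k
  classLoad-↭ p i k = sumOf-↭ timeOf (filter-↭ (onMachineAs? i k) p)

  machineLoad-↭ : ∀ s {xs ys} → xs ↭ ys → ∀ i → machineLoad s xs i ≡ machineLoad s ys i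
  machineLoad-↭ s {xs} {ys} p i = cong₂ _+_ (sumOf-cong (classLoad-↭ p i) (allFin K)) (sumOf-cong setup≡ (allFin K))
    where
    setup≡ : ∀ k → setupCost s xs i k ≡ setupCost s ys i k
    setup≡ k = cong (λ b → if b then s k else 0ℚ)
                    (does-⇔ (mk⇔ (Any-resp-↭ p) (Any-resp-↭ (↭-sym p))) (hosts? xs i k) (hosts? ys i k))

  classLoad-nonneg : ∀ {zs} → All (λ e → 0ℚ ≤ timeOf e) zs → ∀ i k → 0ℚ ≤ classLoad zs i k
  classLoad-nonneg zs≥0 i k = sumOf-nonneg timeOf (All.filter⁺ (onMachineAs? i k) zs≥0)

  classLoad-absent : ∀ zs i k → ¬ Hosts zs i k → classLoad zs i k ≡ 0ℚ
  classLoad-absent zs i k ¬hosts = cong (sumOf timeOf) (filter-none (onMachineAs? i k) (All.¬Any⇒All¬ zs ¬hosts))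

  classLoad-pos⇒Hosts : ∀ zs i k → 0ℚ < classLoad zs i k → Hosts zs i k
  classLoad-pos⇒Hosts zs i k 0<load with hosts? zs i k
  ... | yes hosts  = hosts
  ... | no ¬hosts = contradiction (sym (classLoad-absent zs i k ¬hosts)) (λ eq → <-irrefl eq 0<load)

  classLoad-sameClass : ∀ {zs} k → All (λ e → classOf e ≡ k) zs → ∀ i → classLoad zs i k ≡ loadOn i zs
  classLoad-sameClass k [] i = refl
  classLoad-sameClass {e ∷ zs} k (refl ∷ p) i with onMachine? i e | classOf e ≟ᶠ classOf e
  ... | yes _ | yes _ = cong (timeOf e +_) (classLoad-sameClass k p i)
  ... | yes _ | no k≢k = contradiction refl k≢k
  ... | no _  | _     = classLoad-sameClass k p i

  classLoad-otherClass : ∀ {zs k'} → All (λ e → classOf e ≡ k') zs → ∀ i k → ¬ k' ≡ k → classLoad zs i k ≡ 0ℚ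
  classLoad-otherClass p i k k'≢k =
    cong (sumOf timeOf) (filter-none (onMachineAs? i k) (All.map (λ { refl (_ , k'≡k) → k'≢k k'≡k }) p))

classLoad-concatMap : ∀ {m K} {A : Set} (g : A → List (Placement m K)) ks i k →
                      classLoad (concatMap g ks) i k ≡ sumOf (λ a → classLoad (g a) i k) ks
classLoad-concatMap g ks i k = sumOf-filter-concatMap timeOf (onMachineAs? i k) g ks

classTotal : ∀ {K} → List (ℚ × Fin K) → Fin K → ℚ
classTotal js k = sumOf proj₁ (filter (λ x → proj₂ x ≟ᶠ k) js)

module _ {m K : ℕ} where

  private
    weight : Fin m → Fin K → Placement m K → ℚ
    weight i k e = if does (onMachineAs? i k e) then timeOf e else 0ℚ

    classLoad-weight : ∀ zs i k → classLoad zs i k ≡ sumOf (weight i k) zs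
    classLoad-weight zs i k = sumOf-filter timeOf (onMachineAs? i k) zs

    ∑classes-weight : ∀ i e → sumOf (λ k → weight i k e) (allFin K) ≡ (if does (onMachine? i e) then timeOf e else 0ℚ)
    ∑classes-weight i e = sumOf-allFin-indicator (classOf e) (does (onMachine? i e)) (timeOf e)

    ∑machines-weight : ∀ k e → sumOf (λ i → weight i k e) (allFin m) ≡ (if does (classOf e ≟ᶠ k) then timeOf e else 0ℚ)
    ∑machines-weight k e = trans
      (sumOf-cong (λ i → cong (λ b → if b then timeOf e else 0ℚ) (∧-comm (does (onMachine? i e)) _)) (allFin m))
      (sumOf-allFin-indicator (machineOf e) (does (classOf e ≟ᶠ k)) (timeOf e))

  ∑classes-classLoad : ∀ zs i → sumOf (classLoad zs i) (allFin K) ≡ loadOn i zs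
  ∑classes-classLoad zs i = begin
    sumOf (classLoad zs i) (allFin K)                       ≡⟨ sumOf-cong (classLoad-weight zs i) (allFin K) ⟩
    sumOf (λ k → sumOf (weight i k) zs) (allFin K)          ≡⟨ sumOf-comm (λ k e → weight i k e) (allFin K) zs ⟩
    sumOf (λ e → sumOf (λ k → weight i k e) (allFin K)) zs  ≡⟨ sumOf-cong (∑classes-weight i) zs ⟩
    sumOf (λ e → if does (onMachine? i e) then timeOf e else 0ℚ) zs ≡⟨ sumOf-filter timeOf (onMachine? i) zs ⟨
    loadOn i zs                                             ∎
    where open ≡-Reasoning

  ∑machines-classLoad : ∀ zs k → sumOf (λ i → classLoad zs i k) (allFin m) ≡ classTotal (map proj₁ zs) k
  ∑machines-classLoad zs k = begin
    sumOf (λ i → classLoad zs i k) (allFin m)               ≡⟨ sumOf-cong (λ i → classLoad-weight zs i k) (allFin m) ⟩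
    sumOf (λ i → sumOf (weight i k) zs) (allFin m)          ≡⟨ sumOf-comm (λ i e → weight i k e) (allFin m) zs ⟩
    sumOf (λ e → sumOf (λ i → weight i k e) (allFin m)) zs  ≡⟨ sumOf-cong (∑machines-weight k) zs ⟩
    sumOf (λ e → if does (classOf e ≟ᶠ k) then timeOf e else 0ℚ) zs ≡⟨ sumOf-map _ proj₁ zs ⟨
    sumOf (λ x → if does (proj₂ x ≟ᶠ k) then proj₁ x else 0ℚ) (map proj₁ zs) ≡⟨ sumOf-filter proj₁ (λ x → proj₂ x ≟ᶠ k) (map proj₁ zs) ⟨
    classTotal (map proj₁ zs) k                             ∎
    where open ≡-Reasoning

placements : (I : Instance) → Schedule I → List (Placement (m I) (K I))
placements I σ = tabulate (λ j → lookup (jobs I) j , σ j)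

map-proj₁-placements : ∀ I σ → map proj₁ (placements I σ) ≡ jobs I
map-proj₁-placements I σ = trans (map-tabulate _ proj₁) (tabulate-lookup (jobs I))

placements-nonneg : ∀ I σ → All (λ x → 0ℚ ≤ proj₁ x) (jobs I) → All (λ e → 0ℚ ≤ timeOf e) (placements I σ)
placements-nonneg I σ jobs≥0 = All.map⁻ (subst (All _) (sym (map-proj₁-placements I σ)) jobs≥0)

jobs-positive : ∀ I → ValidInstance I → All (λ x → 0ℚ < proj₁ x) (jobs I)
jobs-positive I (ptime>0 , _) = subst (All _) (tabulate-lookup (jobs I)) (All.tabulate⁺ ptime>0)

load≡machineLoad : ∀ I σ i → load I σ i ≡ machineLoad (setup I) (placements I σ) i
load≡machineLoad I σ i = cong₂ _+_ processing setups
  where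
  n = length (jobs I)
  processing : sumOf (ptime I) (filter (λ j → σ j ≟ᶠ i) (allFin n)) ≡ sumOf (classLoad (placements I σ) i) (allFin (K I))
  processing = begin
    sumOf (ptime I) (filter (λ j → σ j ≟ᶠ i) (allFin n))                  ≡⟨ sumOf-filter (ptime I) (λ j → σ j ≟ᶠ i) (allFin n) ⟩
    sumOf (λ j → if does (σ j ≟ᶠ i) then ptime I j else 0ℚ) (allFin n)    ≡⟨ sumOf-tabulate (λ e → if does (onMachine? i e) then timeOf e else 0ℚ) (λ j → lookup (jobs I) j , σ j) ⟨
    sumOf (λ e → if does (onMachine? i e) then timeOf e else 0ℚ) (placements I σ) ≡⟨ sumOf-filter timeOf (onMachine? i) (placements I σ) ⟨
    loadOn i (placements I σ)                                             ≡⟨ ∑classes-classLoad (placements I σ) i ⟨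
    sumOf (classLoad (placements I σ) i) (allFin (K I))                   ∎
    where open ≡-Reasoning
  setups : sumOf (λ k → if does (any? (λ j → (σ j ≟ᶠ i) ×-dec (cls I j ≟ᶠ k))) then setup I k else 0ℚ) (allFin (K I))
           ≡ sumOf (setupCost (setup I) (placements I σ) i) (allFin (K I))
  setups = sumOf-cong (λ k → cong (λ b → if b then setup I k else 0ℚ)
             (does-⇔ (mk⇔ (λ (j , p) → Any.tabulate⁺ j p) Any.tabulate⁻)
               (any? (λ j → (σ j ≟ᶠ i) ×-dec (cls I j ≟ᶠ k))) (hosts? (placements I σ) i k))) (allFin (K I))

scheduleOf : ∀ {A B : Set} (js : List A) (ys : List (A × B)) → js ≡ map proj₁ ys →
             Σ[ σ ∈ (Fin (length js) → B) ] tabulate (λ j → lookup js j , σ j) ≡ ys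
scheduleOf _ []       refl = (λ ()) , refl
scheduleOf _ (y ∷ ys) refl with scheduleOf _ ys refl
... | σ , eq = (λ { zero → proj₂ y ; (suc j) → σ j }) , cong (y ∷_) eq

realize : ∀ I (zs : List (Placement (m I) (K I))) → map proj₁ zs ↭ jobs I →
          ∃ λ (σ : Schedule I) → ∀ i → load I σ i ≡ machineLoad (setup I) zs i
realize I zs ρ with ↭-map-inv proj₁ ρ
... | ys , jobs≡ , zs↭ys with scheduleOf (jobs I) ys jobs≡
... | σ , placements≡ys = σ , λ i → begin
  load I σ i                                 ≡⟨ load≡machineLoad I σ i ⟩
  machineLoad (setup I) (placements I σ) i   ≡⟨ cong (λ zs′ → machineLoad (setup I) zs′ i) placements≡ys ⟩
  machineLoad (setup I) ys i                 ≡⟨ machineLoad-↭ (setup I) zs↭ys i ⟨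
  machineLoad (setup I) zs i                 ∎
  where open ≡-Reasoning

-- Greedy filling of machines

module Greedy {X : Set} (weight : X → ℚ) where

  fill : ℚ → ℚ → List X → List X × List X
  fill c level []       = [] , []
  fill c level (x ∷ xs) with level <? c
  ... | yes _ = Product.map₁ (x ∷_) (fill c (level + weight x) xs)
  ... | no  _ = [] , x ∷ xs

  fill-++ : ∀ c level xs → proj₁ (fill c level xs) ++ proj₂ (fill c level xs) ≡ xs
  fill-++ c level []       = refl
  fill-++ c level (x ∷ xs) with level <? c
  ... | yes _ = cong (x ∷_) (fill-++ c (level + weight x) xs)
  ... | no  _ = refl

  fill-idle : ∀ {c level} → ¬ level < c → ∀ xs → proj₁ (fill c level xs) ≡ []
  fill-idle _ []        = refl
  fill-idle {c} {level} ¬level<c (x ∷ xs) with level <? c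
  ... | yes level<c = contradiction level<c ¬level<c
  ... | no  _       = refl

  fill-full : ∀ c level xs → proj₂ (fill c level xs) ≡ [] ⊎ c ≤ level + sumOf weight (proj₁ (fill c level xs))
  fill-full c level []       = inj₁ refl
  fill-full c level (x ∷ xs) with level <? c
  ... | yes _ = Sum.map₂ (λ full → ≤-trans full (≤-reflexive (+-assoc level (weight x) _)))
                              (fill-full c (level + weight x) xs)
  ... | no level≮c = inj₂ (subst (c ≤_) (sym (+-identityʳ level)) (≮⇒≥ level≮c))

  fill-≤ : ∀ {δ} c level xs → All (λ x → weight x ≤ δ) xs → level ≤ c + δ →
           level + sumOf weight (proj₁ (fill c level xs)) ≤ c + δ
  fill-≤ c level []       _ level≤ = subst (_≤ _) (sym (+-identityʳ level)) level≤
  fill-≤ c level (x ∷ xs) (wx≤δ ∷ w≤δ) level≤ with level <? c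
  ... | yes level<c = subst (_≤ _) (+-assoc level (weight x) _)
                        (fill-≤ c (level + weight x) xs w≤δ (+-mono-≤ (<⇒≤ level<c) wx≤δ))
  ... | no  _       = subst (_≤ _) (sym (+-identityʳ level)) level≤

  module _ {m : ℕ} (cap : Fin m → ℚ) where

    greedy : List (Fin m) → List X → List (X × Fin m)
    greedy []       xs = []
    greedy (i ∷ is) xs = map (_, i) (proj₁ (fill (cap i) 0ℚ xs)) ++ greedy is (proj₂ (fill (cap i) 0ℚ xs))

    weightOn : Fin m → List (X × Fin m) → ℚ
    weightOn i zs = sumOf (weight ∘ proj₁) (filter (λ e → proj₂ e ≟ᶠ i) zs)

    greedy-[] : ∀ is → greedy is [] ≡ []
    greedy-[] []       = refl
    greedy-[] (i ∷ is) = greedy-[] is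

    greedy-covers : ∀ {slack} → 0ℚ ≤ slack → ∀ is xs → All (λ x → slack < weight x) xs →
                    sumOf weight xs ≤ sumOf cap is + slack → map proj₁ (greedy is xs) ≡ xs
    greedy-covers 0≤slack []       []       _ _ = refl
    greedy-covers {slack} 0≤slack [] (x ∷ xs) (slack<wx ∷ slack<w) total≤ =
      contradiction (<-≤-trans (<-≤-trans slack<wx wx≤total) (≤-trans total≤ (≤-reflexive (+-identityˡ slack)))) (<-irrefl refl)
      where
      wx≤total : weight x ≤ weight x + sumOf weight xs
      wx≤total = p≤p+q (sumOf-nonneg weight (All.map (λ slack<wy → <⇒≤ (≤-<-trans 0≤slack slack<wy)) slack<w))
    greedy-covers {slack} 0≤slack (i ∷ is) xs slack<w total≤ = begin
      map proj₁ (map (_, i) H ++ greedy is R)              ≡⟨ map-++ proj₁ (map (_, i) H) _ ⟩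
      map proj₁ (map (_, i) H) ++ map proj₁ (greedy is R)  ≡⟨ cong₂ _++_ (trans (sym (map-∘ H)) (map-id H)) rest ⟩
      H ++ R                                               ≡⟨ fill-++ (cap i) 0ℚ xs ⟩
      xs                                                   ∎
      where
      open ≡-Reasoning
      H = proj₁ (fill (cap i) 0ℚ xs)
      R = proj₂ (fill (cap i) 0ℚ xs)
      rest : map proj₁ (greedy is R) ≡ R
      rest with fill-full (cap i) 0ℚ xs
      ... | inj₁ R≡[] = trans (cong (map proj₁ ∘ greedy is) R≡[]) (trans (cong (map proj₁) (greedy-[] is)) (sym R≡[]))
      ... | inj₂ full = greedy-covers 0≤slack is R (All.++⁻ʳ H (subst (All _) (sym (fill-++ (cap i) 0ℚ xs)) slack<w)) R≤
        where
        R≤ : sumOf weight R ≤ sumOf cap is + slack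
        R≤ = +-cancelˡ-≤ (sumOf weight H) (≤-trans split≤ (+-monoˡ-≤ _ (subst (cap i ≤_) (+-identityˡ (sumOf weight H)) full)))
          where
          split≤ : sumOf weight H + sumOf weight R ≤ cap i + (sumOf cap is + slack)
          split≤ = subst₂ _≤_ (trans (cong (sumOf weight) (sym (fill-++ (cap i) 0ℚ xs))) (sumOf-++ weight H R))
                              (+-assoc (cap i) _ slack) total≤

    greedy-usesCapacity : ∀ is xs → All (λ e → 0ℚ < cap (proj₂ e)) (greedy is xs)
    greedy-usesCapacity []       xs = []
    greedy-usesCapacity (i ∷ is) xs = All.++⁺ onFirst (greedy-usesCapacity is (proj₂ (fill (cap i) 0ℚ xs)))
      where
      onFirst : All (λ e → 0ℚ < cap (proj₂ e)) (map (_, i) (proj₁ (fill (cap i) 0ℚ xs)))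
      onFirst with 0ℚ <? cap i
      ... | yes 0<cap = All.map⁺ (All.universal (λ _ → 0<cap) _)
      ... | no  0≮cap = subst (λ H → All _ (map (_, i) H)) (sym (fill-idle 0≮cap xs)) []

    greedy-weightOn : ∀ {δ} → 0ℚ ≤ δ → (∀ j → 0ℚ ≤ cap j) → ∀ i′ is xs → All (λ x → weight x ≤ δ) xs →
                      weightOn i′ (greedy is xs) ≤ sumOf (λ j → if does (i′ ≟ᶠ j) then cap i′ + δ else 0ℚ) is
    greedy-weightOn 0≤δ 0≤cap i′ []       xs w≤δ = ≤-refl
    greedy-weightOn {δ} 0≤δ 0≤cap i′ (i ∷ is) xs w≤δ = begin
      weightOn i′ (map (_, i) H ++ greedy is R)               ≡⟨ sumOf-filter-++ (weight ∘ proj₁) (λ e → proj₂ e ≟ᶠ i′) (map (_, i) H) _ ⟩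
      weightOn i′ (map (_, i) H) + weightOn i′ (greedy is R)  ≤⟨ +-mono-≤ onFirst (greedy-weightOn 0≤δ 0≤cap i′ is R w≤δ-rest) ⟩
      (if does (i′ ≟ᶠ i) then cap i′ + δ else 0ℚ) + sumOf (λ j → if does (i′ ≟ᶠ j) then cap i′ + δ else 0ℚ) is ∎
      where
      open ≤-Reasoning
      H = proj₁ (fill (cap i) 0ℚ xs)
      R = proj₂ (fill (cap i) 0ℚ xs)
      w≤δ-rest : All (λ x → weight x ≤ δ) R
      w≤δ-rest = All.++⁻ʳ H (subst (All _) (sym (fill-++ (cap i) 0ℚ xs)) w≤δ)
      onFirst : weightOn i′ (map (_, i) H) ≤ (if does (i′ ≟ᶠ i) then cap i′ + δ else 0ℚ)
      onFirst with i′ ≟ᶠ i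
      ... | yes refl = begin
        weightOn i (map (_, i) H)              ≡⟨ cong (sumOf (weight ∘ proj₁)) (filter-all (λ e → proj₂ e ≟ᶠ i) (All.map⁺ (All.universal (λ _ → refl) H))) ⟩
        sumOf (weight ∘ proj₁) (map (_, i) H)  ≡⟨ sumOf-map (weight ∘ proj₁) (_, i) H ⟩
        sumOf weight H                         ≡⟨ +-identityˡ _ ⟨
        0ℚ + sumOf weight H                    ≤⟨ fill-≤ (cap i) 0ℚ xs w≤δ (subst (_≤ cap i + δ) (+-identityˡ 0ℚ) (+-mono-≤ (0≤cap i) 0≤δ)) ⟩
        cap i + δ                              ∎
      ... | no i′≢i = ≤-reflexive (cong (sumOf (weight ∘ proj₁))
                        (filter-none (λ e → proj₂ e ≟ᶠ i′) (All.map⁺ (All.universal (λ _ → i′≢i ∘ sym) H))))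

    greedy-allFin-weightOn : ∀ {δ} → 0ℚ ≤ δ → (∀ j → 0ℚ ≤ cap j) → ∀ i xs → All (λ x → weight x ≤ δ) xs →
                             weightOn i (greedy (allFin m) xs) ≤ cap i + δ
    greedy-allFin-weightOn {δ} 0≤δ 0≤cap i xs w≤δ = ≤-trans (greedy-weightOn 0≤δ 0≤cap i (allFin m) xs w≤δ)
      (≤-reflexive (sumOf-allFin-indicator i true (cap i + δ)))

-- Regrouping the small jobs

module Stretch {K : ℕ} (s : Fin K → ℚ) {δ ε : ℚ} (0≤ε : 0ℚ ≤ ε) (0≤s : ∀ k → 0ℚ ≤ s k) (δ≤εs : ∀ k → δ ≤ ε * s k) where

  private
    1+ε≥0 : 0ℚ ≤ 1ℚ + ε
    1+ε≥0 = ≤-trans (p≤p+q {0ℚ} 0≤ε) (+-monoˡ-≤ ε {0ℚ} {1ℚ} (*≤* (ℤ.+≤+ z≤n)))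

    setup≤ : ∀ k b → (if b then s k else 0ℚ) ≤ s k
    setup≤ k true  = ≤-refl
    setup≤ k false = 0≤s k

    absorb : ∀ {p} k → 0ℚ ≤ p → (p + δ) + s k ≤ (1ℚ + ε) * (p + s k)
    absorb {p} k 0≤p = begin
      (p + δ) + s k               ≡⟨ solve 3 (λ p d s → (p :+ d) :+ s := (p :+ s) :+ d) refl p δ (s k) ⟩
      (p + s k) + δ               ≤⟨ +-monoʳ-≤ (p + s k) (≤-trans (δ≤εs k) (*-monoˡ-≤-nonNeg ε {{nonNegative 0≤ε}} s≤p+s)) ⟩
      (p + s k) + ε * (p + s k)   ≡⟨ solve 2 (λ e x → x :+ e :* x := (con 1ℚ :+ e) :* x) refl ε (p + s k) ⟩
      (1ℚ + ε) * (p + s k)        ∎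
      where
      open ≤-Reasoning
      open +-*-Solver
      s≤p+s : s k ≤ p + s k
      s≤p+s = subst (_≤ p + s k) (+-identityˡ (s k)) (+-monoˡ-≤ (s k) 0≤p)

  classCost-stretch : ∀ {m} (X Y : List (Placement m K)) i k → All (λ e → 0ℚ ≤ timeOf e) X →
                      (Hosts Y i k → Hosts X i k) → classLoad Y i k ≤ classLoad X i k + δ →
                      classLoad Y i k + setupCost s Y i k ≤ (1ℚ + ε) * (classLoad X i k + setupCost s X i k)
  classCost-stretch X Y i k X≥0 Y⇒X Y≤X+δ with hosts? X i k | hosts? Y i k
  ... | yes _ | hostsY? = begin
    classLoad Y i k + (if does hostsY? then s k else 0ℚ)  ≤⟨ +-mono-≤ Y≤X+δ (setup≤ k (does hostsY?)) ⟩
    (classLoad X i k + δ) + s k                          ≤⟨ absorb k (classLoad-nonneg X≥0 i k) ⟩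
    (1ℚ + ε) * (classLoad X i k + s k)                   ∎
    where open ≤-Reasoning
  ... | no ¬hostsX | yes hostsY = contradiction (Y⇒X hostsY) ¬hostsX
  ... | no _ | no ¬hostsY = begin
    classLoad Y i k + 0ℚ                 ≡⟨ cong (_+ 0ℚ) (classLoad-absent Y i k ¬hostsY) ⟩
    0ℚ                                   ≡⟨ *-zeroʳ (1ℚ + ε) ⟨
    (1ℚ + ε) * 0ℚ                        ≤⟨ *-monoˡ-≤-nonNeg (1ℚ + ε) {{nonNegative 1+ε≥0}}
                                             (subst (0ℚ ≤_) (sym (+-identityʳ _)) (classLoad-nonneg X≥0 i k)) ⟩
    (1ℚ + ε) * (classLoad X i k + 0ℚ)    ∎
    where open ≤-Reasoning

  machineLoad-stretch : ∀ {m} (X Y : List (Placement m K)) i → All (λ e → 0ℚ ≤ timeOf e) X →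
                        (∀ k → Hosts Y i k → Hosts X i k) → (∀ k → classLoad Y i k ≤ classLoad X i k + δ) →
                        machineLoad s Y i ≤ (1ℚ + ε) * machineLoad s X i
  machineLoad-stretch X Y i X≥0 Y⇒X Y≤X+δ = begin
    machineLoad s Y i                                                  ≡⟨ sumOf-+ {f = classLoad Y i} {g = setupCost s Y i} (allFin K) ⟨
    sumOf (classCost Y) (allFin K)                                     ≤⟨ sumOf-mono (All.universal stretch (allFin K)) ⟩
    sumOf (λ k → (1ℚ + ε) * classCost X k) (allFin K)                  ≡⟨ sumOf-*ˡ (classCost X) (1ℚ + ε) (allFin K) ⟩
    (1ℚ + ε) * sumOf (classCost X) (allFin K)                          ≡⟨ cong ((1ℚ + ε) *_) (sumOf-+ {f = classLoad X i} {g = setupCost s X i} (allFin K)) ⟩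
    (1ℚ + ε) * machineLoad s X i                                       ∎
    where
    open ≤-Reasoning
    classCost : List (Placement _ K) → Fin K → ℚ
    classCost Z k = classLoad Z i k + setupCost s Z i k
    stretch : ∀ k → classCost Y k ≤ (1ℚ + ε) * classCost X k
    stretch k = classCost-stretch X Y i k X≥0 (Y⇒X k) (Y≤X+δ k)

-- The class-k items overfill the freed class-k capacity by at most slack k, which is smaller than
-- any single item; this is what lets the greedy filling place all of them.
module Regroup {m K : ℕ} (s : Fin K → ℚ) {δ ε : ℚ} (0≤δ : 0ℚ ≤ δ) (0≤ε : 0ℚ ≤ ε) (0≤s : ∀ k → 0ℚ ≤ s k)
  (δ≤εs : ∀ k → δ ≤ ε * s k)
  (X big small : List (Placement m K)) (split : X ↭ big ++ small) (X≥0 : All (λ e → 0ℚ ≤ timeOf e) X)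
  (items : Fin K → List (ℚ × Fin K)) (slack : Fin K → ℚ) (0≤slack : ∀ k → 0ℚ ≤ slack k)
  (items-class : ∀ k → All (λ x → proj₂ x ≡ k) (items k))
  (items-size : ∀ k → All (λ x → slack k < proj₁ x × proj₁ x ≤ δ) (items k))
  (items-fit : ∀ k → sumOf proj₁ (items k) ≤ classTotal (map proj₁ small) k + slack k)
  where

  open Greedy (proj₁ {B = λ _ → Fin K})
  open Stretch s 0≤ε 0≤s δ≤εs

  capacity : Fin K → Fin m → ℚ
  capacity k i = classLoad small i k

  block : Fin K → List (Placement m K)
  block k = greedy (capacity k) (allFin m) (items k)

  regrouped : List (Placement m K)
  regrouped = big ++ concatMap block (allFin K)

  small≥0 : All (λ e → 0ℚ ≤ timeOf e) small
  small≥0 = All.++⁻ʳ big (All-resp-↭ split X≥0)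

  block-jobs : ∀ k → map proj₁ (block k) ≡ items k
  block-jobs k = greedy-covers (capacity k) (0≤slack k) (allFin m) (items k) (All.map proj₁ (items-size k))
    (subst (λ c → sumOf proj₁ (items k) ≤ c + slack k) (sym (∑machines-classLoad small k)) (items-fit k))

  block-class : ∀ k → All (λ e → classOf e ≡ k) (block k)
  block-class k = All.map⁻ (subst (All (λ x → proj₂ x ≡ k)) (sym (block-jobs k)) (items-class k))

  classLoad-block : ∀ i k → classLoad (block k) i k ≤ classLoad small i k + δ
  classLoad-block i k = subst (_≤ classLoad small i k + δ) (sym (classLoad-sameClass k (block-class k) i))
    (greedy-allFin-weightOn (capacity k) 0≤δ (λ j → classLoad-nonneg small≥0 j k) i (items k) (All.map proj₂ (items-size k)))

  classLoad-blocks : ∀ i k → classLoad (concatMap block (allFin K)) i k ≡ classLoad (block k) i k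
  classLoad-blocks i k = trans (classLoad-concatMap block (allFin K) i k)
    (sumOf-allFin-single (λ k′ → classLoad (block k′) i k) k (λ k′ k′≢k → classLoad-otherClass (block-class k′) i k k′≢k))

  classLoad-regrouped : ∀ i k → classLoad regrouped i k ≤ classLoad X i k + δ
  classLoad-regrouped i k = begin
    classLoad regrouped i k                                  ≡⟨ classLoad-++ big (concatMap block (allFin K)) i k ⟩
    classLoad big i k + classLoad (concatMap block (allFin K)) i k ≡⟨ cong (classLoad big i k +_) (classLoad-blocks i k) ⟩
    classLoad big i k + classLoad (block k) i k              ≤⟨ +-monoʳ-≤ (classLoad big i k) (classLoad-block i k) ⟩
    classLoad big i k + (classLoad small i k + δ)            ≡⟨ +-assoc (classLoad big i k) _ δ ⟨
    (classLoad big i k + classLoad small i k) + δ            ≡⟨ cong (_+ δ) (classLoad-++ big small i k) ⟨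
    classLoad (big ++ small) i k + δ                         ≡⟨ cong (_+ δ) (classLoad-↭ split i k) ⟨
    classLoad X i k + δ                                      ∎
    where open ≤-Reasoning

  hosts-block : ∀ k′ i k → Hosts (block k′) i k → Hosts small i k
  hosts-block k′ i k h with All.lookupAny (All.zip (block-class k′ , greedy-usesCapacity (capacity k′) (allFin m) (items k′))) h
  ... | (class≡k′ , 0<cap) , (machine≡i , class≡k) =
    subst₂ (Hosts small) machine≡i (trans (sym class≡k′) class≡k) (classLoad-pos⇒Hosts small _ k′ 0<cap)

  hosts-regrouped : ∀ i k → Hosts regrouped i k → Hosts X i k
  hosts-regrouped i k h = Any-resp-↭ (↭-sym split) (fromParts (Any.++⁻ big h))
    where
    fromParts : Hosts big i k ⊎ Hosts (concatMap block (allFin K)) i k → Hosts (big ++ small) i k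
    fromParts (inj₁ inBig)    = Any.++⁺ˡ inBig
    fromParts (inj₂ inBlocks) with Any.satisfied (Any.concatMap⁻ block {xs = allFin K} inBlocks)
    ... | k′ , inBlock = Any.++⁺ʳ big (hosts-block k′ i k inBlock)

  regrouped-jobs : map proj₁ regrouped ≡ map proj₁ big ++ concatMap items (allFin K)
  regrouped-jobs = trans (map-++ proj₁ big _)
    (cong (map proj₁ big ++_) (trans (map-concatMap proj₁ block (allFin K)) (concatMap-cong block-jobs (allFin K))))

  regrouped-load : ∀ i → machineLoad s regrouped i ≤ (1ℚ + ε) * machineLoad s X i
  regrouped-load i = machineLoad-stretch X regrouped i X≥0 (hosts-regrouped i) (classLoad-regrouped i)

module Rounding (I : Instance) {δ ε : ℚ} (0<δ : 0ℚ < δ) (0≤ε : 0ℚ ≤ ε) (0≤s : ∀ k → 0ℚ ≤ setup I k)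
                (δ≤εs : ∀ k → δ ≤ ε * setup I k) (jobs>0 : All (λ x → 0ℚ < proj₁ x) (jobs I)) where

  small? : Decidable (λ (x : ℚ × Fin (K I)) → proj₁ x < δ)
  small? x = proj₁ x <? δ

  smallOfClass? : (k : Fin (K I)) → Decidable (λ (x : ℚ × Fin (K I)) → proj₁ x < δ × proj₂ x ≡ k)
  smallOfClass? k x = small? x ×-dec (proj₂ x ≟ᶠ k)

  smallSum : Fin (K I) → ℚ
  smallSum k = sumOf proj₁ (filter (smallOfClass? k) (jobs I))

  blockCount : Fin (K I) → ℕ
  blockCount k = ceilDiv (smallSum k) δ

  blocks : Fin (K I) → List (ℚ × Fin (K I))
  blocks k = replicate (blockCount k) (δ , k)

  blockVolume : Fin (K I) → ℚ
  blockVolume k = sumℚ (replicate (blockCount k) δ)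

  rounded : Instance
  rounded = roundSmall I δ

  jobs≥0 : All (λ x → 0ℚ ≤ proj₁ x) (jobs I)
  jobs≥0 = All.map <⇒≤ jobs>0

  volume-bounds : ∀ k → smallSum k ≤ blockVolume k × blockVolume k < smallSum k + δ
  volume-bounds k = ceilDiv-bounds (smallSum k) δ (sumOf-nonneg proj₁ (All.filter⁺ (smallOfClass? k) jobs≥0)) 0<δ

  blocks-volume : ∀ k → sumOf proj₁ (blocks k) ≡ blockVolume k
  blocks-volume k = cong sumℚ (map-replicate proj₁ (blockCount k) (δ , k))

  smallSum≡classTotal : ∀ k → classTotal (filter small? (jobs I)) k ≡ smallSum k
  smallSum≡classTotal k = cong (sumOf proj₁) (filter-filter small? (λ x → proj₂ x ≟ᶠ k) (jobs I))

  roundUp : (σ : Schedule I) → ∃ λ (σ′ : Schedule rounded) → ∀ i → load rounded σ′ i ≤ (1ℚ + ε) * load I σ i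
  roundUp σ = proj₁ realized , λ i → begin
    load rounded (proj₁ realized) i              ≡⟨ proj₂ realized i ⟩
    machineLoad (setup I) regrouped i            ≤⟨ regrouped-load i ⟩
    (1ℚ + ε) * machineLoad (setup I) X i         ≡⟨ cong ((1ℚ + ε) *_) (load≡machineLoad I σ i) ⟨
    (1ℚ + ε) * load I σ i                        ∎
    where
    open ≤-Reasoning
    X = placements I σ
    slack : Fin (K I) → ℚ
    slack k = blockVolume k - smallSum k
    slack≥0 : ∀ k → 0ℚ ≤ slack k
    slack≥0 k = subst (_≤ slack k) (+-inverseʳ (smallSum k)) (+-monoˡ-≤ (- smallSum k) (proj₁ (volume-bounds k)))
    slack<δ : ∀ k → slack k < δ
    slack<δ k = subst (slack k <_) (solve 2 (λ s d → (s :+ d) :- s := d) refl (smallSum k) δ)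
                      (+-monoˡ-< (- smallSum k) (proj₂ (volume-bounds k)))
      where open +-*-Solver
    small-jobs : map proj₁ (filter (small? ∘ proj₁) X) ≡ filter small? (jobs I)
    small-jobs = trans (map-filter small? proj₁ X) (cong (filter small?) (map-proj₁-placements I σ))
    fit : ∀ k → sumOf proj₁ (blocks k) ≤ classTotal (map proj₁ (filter (small? ∘ proj₁) X)) k + slack k
    fit k = ≤-reflexive (begin-equality
      sumOf proj₁ (blocks k)        ≡⟨ blocks-volume k ⟩
      blockVolume k                 ≡⟨ solve 2 (λ v s → v := s :+ (v :- s)) refl (blockVolume k) (smallSum k) ⟩
      smallSum k + slack k          ≡⟨ cong (_+ slack k) (trans (cong (λ js → classTotal js k) small-jobs) (smallSum≡classTotal k)) ⟨
      classTotal (map proj₁ (filter (small? ∘ proj₁) X)) k + slack k ∎)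
      where open +-*-Solver
    open Regroup (setup I) (<⇒≤ 0<δ) 0≤ε 0≤s δ≤εs X (filter (¬? ∘ small? ∘ proj₁) X) (filter (small? ∘ proj₁) X)
      (↭-filter-split (small? ∘ proj₁) X) (placements-nonneg I σ jobs≥0) blocks slack
      slack≥0 (λ k → All.replicate⁺ (blockCount k) refl) (λ k → All.replicate⁺ (blockCount k) (slack<δ k , ≤-refl))
      fit
    rounded-jobs : map proj₁ regrouped ≡ jobs rounded
    rounded-jobs = trans regrouped-jobs (cong (_++ concatMap blocks (allFin (K I)))
      (trans (map-filter (¬? ∘ small?) proj₁ X) (cong (filter (¬? ∘ small?)) (map-proj₁-placements I σ))))
    realized = realize rounded regrouped (↭-reflexive rounded-jobs)

  blocks-classTotal : ∀ k → classTotal (concatMap blocks (allFin (K I))) k ≡ blockVolume k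
  blocks-classTotal k = begin
    classTotal (concatMap blocks (allFin (K I))) k      ≡⟨ sumOf-filter-concatMap proj₁ (λ x → proj₂ x ≟ᶠ k) blocks (allFin (K I)) ⟩
    sumOf (λ k′ → classTotal (blocks k′) k) (allFin (K I)) ≡⟨ sumOf-allFin-single (λ k′ → classTotal (blocks k′) k) k other ⟩
    classTotal (blocks k) k                             ≡⟨ cong (sumOf proj₁) (filter-all (λ x → proj₂ x ≟ᶠ k) (All.replicate⁺ (blockCount k) refl)) ⟩
    sumOf proj₁ (blocks k)                              ≡⟨ blocks-volume k ⟩
    blockVolume k                                       ∎
    where
    open ≡-Reasoning
    other : ∀ k′ → ¬ k′ ≡ k → classTotal (blocks k′) k ≡ 0ℚ
    other k′ k′≢k = cong (sumOf proj₁) (filter-none (λ x → proj₂ x ≟ᶠ k) (All.replicate⁺ (blockCount k′) k′≢k))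

  large++smallByClass↭jobs : filter (¬? ∘ small?) (jobs I) ++ concatMap (λ k → filter (smallOfClass? k) (jobs I)) (allFin (K I)) ↭ jobs I
  large++smallByClass↭jobs = begin
    filter (¬? ∘ small?) (jobs I) ++ concatMap (λ k → filter (smallOfClass? k) (jobs I)) (allFin (K I))
      ↭⟨ ++⁺ˡ _ (↭-sym (filter-↭-concatMap-byKey small? proj₂ (jobs I))) ⟩
    filter (¬? ∘ small?) (jobs I) ++ filter small? (jobs I)
      ↭⟨ ↭-filter-split small? (jobs I) ⟨
    jobs I ∎
    where open PermutationReasoning

  roundDown : (σ : Schedule rounded) → ∃ λ (σ′ : Schedule I) → ∀ i → load I σ′ i ≤ (1ℚ + ε) * load rounded σ i
  roundDown σ with map-++⁻ proj₁ (placements rounded σ) (map-proj₁-placements rounded σ)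
  ... | big , small , X≡ , big-jobs , small-jobs = proj₁ realized , λ i → begin
    load I (proj₁ realized) i                    ≡⟨ proj₂ realized i ⟩
    machineLoad (setup I) regrouped i            ≤⟨ regrouped-load i ⟩
    (1ℚ + ε) * machineLoad (setup I) X i         ≡⟨ cong ((1ℚ + ε) *_) (load≡machineLoad rounded σ i) ⟨
    (1ℚ + ε) * load rounded σ i                  ∎
    where
    open ≤-Reasoning
    X = placements rounded σ
    items : Fin (K I) → List (ℚ × Fin (K I))
    items k = filter (smallOfClass? k) (jobs I)
    X≥0 : All (λ e → 0ℚ ≤ timeOf e) X
    X≥0 = placements-nonneg rounded σ (All.++⁺ (All.filter⁺ (¬? ∘ small?) jobs≥0)
            (All.concat⁺ (All.map⁺ (All.universal (λ k → All.replicate⁺ (blockCount k) (<⇒≤ 0<δ)) (allFin (K I))))))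
    fit : ∀ k → sumOf proj₁ (items k) ≤ classTotal (map proj₁ small) k + 0ℚ
    fit k = subst (smallSum k ≤_) (trans (sym (blocks-classTotal k)) (trans (cong (λ js → classTotal js k) (sym small-jobs)) (sym (+-identityʳ _))))
                  (proj₁ (volume-bounds k))
    open Regroup (setup I) (<⇒≤ 0<δ) 0≤ε 0≤s δ≤εs X big small (↭-reflexive X≡) X≥0 items (λ _ → 0ℚ) (λ _ → ≤-refl)
      (λ k → All.map proj₂ (All.all-filter (smallOfClass? k) (jobs I)))
      (λ k → All.zipWith (λ (0<p , p<δ , _) → 0<p , <⇒≤ p<δ) (All.filter⁺ (smallOfClass? k) jobs>0 , All.all-filter (smallOfClass? k) (jobs I)))
      fit
    jobs↭ : map proj₁ regrouped ↭ jobs I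
    jobs↭ = ↭-trans (↭-reflexive (trans regrouped-jobs (cong (_++ concatMap items (allFin (K I))) big-jobs))) large++smallByClass↭jobs
    realized = realize I regrouped jobs↭

Feasible : ∀ {n} → (Fin n → ℚ) → ℚ → ℚ → Set
Feasible loads T′ L′ = (∀ i → loads i ≤ T′) × (L′ ≤ sumOf (λ i → T′ - loads i) (allFin _))

-- Bounding ℓ′ by ℓ + εT′ rather than by (1+ε)ℓ keeps the free space from shrinking, which matters when L′ < 0.
Feasible-stretch : ∀ {n} {ℓ ℓ′ : Fin n → ℚ} {ε T′ L′} → 0ℚ ≤ ε → (∀ i → ℓ′ i ≤ (1ℚ + ε) * ℓ i) →
                   Feasible ℓ T′ L′ → Feasible ℓ′ ((1ℚ + ε) * T′) L′
Feasible-stretch {n} {ℓ} {ℓ′} {ε} {T′} 0≤ε ℓ′≤ (ℓ≤T′ , L′≤free) =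
  makespan , ≤-trans L′≤free (sumOf-mono (All.universal more-free (allFin n)))
  where
  open ≤-Reasoning
  open +-*-Solver
  ℓ′≤ℓ+εT′ : ∀ i → ℓ′ i ≤ ℓ i + ε * T′
  ℓ′≤ℓ+εT′ i = begin
    ℓ′ i                ≤⟨ ℓ′≤ i ⟩
    (1ℚ + ε) * ℓ i      ≡⟨ solve 2 (λ e l → (con 1ℚ :+ e) :* l := l :+ e :* l) refl ε (ℓ i) ⟩
    ℓ i + ε * ℓ i       ≤⟨ +-monoʳ-≤ (ℓ i) (*-monoˡ-≤-nonNeg ε {{nonNegative 0≤ε}} (ℓ≤T′ i)) ⟩
    ℓ i + ε * T′        ∎
  makespan : ∀ i → ℓ′ i ≤ (1ℚ + ε) * T′
  makespan i = begin
    ℓ′ i                ≤⟨ ℓ′≤ℓ+εT′ i ⟩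
    ℓ i + ε * T′        ≤⟨ +-monoˡ-≤ (ε * T′) (ℓ≤T′ i) ⟩
    T′ + ε * T′         ≡⟨ solve 2 (λ e t → t :+ e :* t := (con 1ℚ :+ e) :* t) refl ε T′ ⟩
    (1ℚ + ε) * T′       ∎
  more-free : ∀ i → T′ - ℓ i ≤ (1ℚ + ε) * T′ - ℓ′ i
  more-free i = begin
    T′ - ℓ i                          ≡⟨ solve 3 (λ e t l → t :- l := (con 1ℚ :+ e) :* t :- (l :+ e :* t)) refl ε T′ (ℓ i) ⟩
    (1ℚ + ε) * T′ - (ℓ i + ε * T′)    ≤⟨ +-monoʳ-≤ ((1ℚ + ε) * T′) (neg-antimono-≤ (ℓ′≤ℓ+εT′ i)) ⟩
    (1ℚ + ε) * T′ - ℓ′ i              ∎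

lemma7 : (I₂ : Instance) → ValidInstance I₂
  → (ε T : ℚ) → 0ℚ < ε → ε ≤ ½ → (∃ λ (z : ℤ) → ε * (z / 1) ≡ 1ℚ) → 0ℚ < T
  → (∀ (k : Fin (K I₂)) → ε * ε * ε * T ≤ setup I₂ k)
  → (T' L' : ℚ)
  → (HasSchedule I₂ T' L' → HasSchedule (roundSmall I₂ (ε * ε * ε * ε * T)) ((1ℚ + ε) * T') L')
    × (HasSchedule (roundSmall I₂ (ε * ε * ε * ε * T)) T' L' → HasSchedule I₂ ((1ℚ + ε) * T') L')
lemma7 I₂ valid ε T 0<ε _ _ 0<T ε³T≤s T' L' =
  (λ (σ , feasible) → let (σ′ , σ′≤) = roundUp σ   in σ′ , Feasible-stretch 0≤ε σ′≤ feasible) ,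
  (λ (σ , feasible) → let (σ′ , σ′≤) = roundDown σ in σ′ , Feasible-stretch 0≤ε σ′≤ feasible)
  where
  0≤ε = <⇒≤ 0<ε
  δ≤εs : ∀ k → ε * ε * ε * ε * T ≤ ε * setup I₂ k
  δ≤εs k = subst (_≤ ε * setup I₂ k) (solve 2 (λ e t → e :* (e :* e :* e :* t) := e :* e :* e :* e :* t) refl ε T)
                 (*-monoˡ-≤-nonNeg ε {{nonNegative 0≤ε}} (ε³T≤s k))
    where open +-*-Solver
  open Rounding I₂ (*-pos (*-pos (*-pos (*-pos 0<ε 0<ε) 0<ε) 0<ε) 0<T) 0≤ε (λ k → <⇒≤ (proj₂ valid k)) δ≤εs
                (jobs-positive I₂ valid)
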